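{- For every $\eta$ with $0<\eta<1/3$ and every $K\ge1/\eta$, if $G=(V,E)$ is a two-coloured $(1-\eta)$-complete graph on $K$ vertices and $F$ is its largest monochromatic component, then $|F|\ge(1-3\eta)K$.
   Context: A two-coloured graph has each edge coloured red or blue. A graph on $K$ vertices is $(1-\eta)$-complete if its minimum degree is at least $(1-\eta)(K-1)$. A monochromatic component is a connected component of the red subgraph or of the blue subgraph (spanning subgraphs consisting of the red, respectively blue, edges); $|F|$ denotes its number of vertices. -}

module Defs where

open import Data.Nat using (ℕ)
open import Data.Bool using (Bool; true; false)
open import Data.Fin using (Fin)
open import Data.Fin.Subset using (Subset; _∈_; ∣_∣)
open import Data.Vec using (tabulate)
open import Data.Integer using (+_)
open import Data.Rational using (ℚ; _/_; _-_; _*_; _≤_; 1ℚ)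
open import Relation.Binary.PropositionalEquality using (_≡_)
open import Relation.Binary.Construct.Closure.ReflexiveTransitive using (Star)
open import Data.Product using (Σ; _×_)

ℕ→ℚ : ℕ → ℚ
ℕ→ℚ n = (+ n) / 1

data Colour : Set where
  red blue : Colour

-- A two-coloured (simple) graph on vertex set Fin K:
-- adjacency is a symmetric irreflexive Bool matrix, and every pair carries a
-- colour (only meaningful on edges), symmetric in its arguments.
record TwoColouredGraph (K : ℕ) : Set where
  field
    adj     : Fin K → Fin K → Bool
    adj-sym : ∀ u v → adj u v ≡ adj v u
    adj-irr : ∀ v → adj v v ≡ false
    col     : Fin K → Fin K → Colour
    col-sym : ∀ u v → col u v ≡ col v u

  nbhd : Fin K → Subset K
  nbhd v = tabulate (λ w → adj v w)

  degree : Fin K → ℕ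
  degree v = ∣ nbhd v ∣

  Edge : Colour → Fin K → Fin K → Set
  Edge c u v = (adj u v ≡ true) × (col u v ≡ c)

  Connected : Colour → Fin K → Fin K → Set
  Connected c = Star (Edge c)

AlmostComplete : {K : ℕ} → ℚ → TwoColouredGraph K → Set
AlmostComplete {K} η G =
  ∀ v → (1ℚ - η) * (ℕ→ℚ K - 1ℚ) ≤ ℕ→ℚ (TwoColouredGraph.degree G v)

-- The largest monochromatic component has at least m (rational) vertices:
-- some monochromatic component (colour c, containing v) contains a set S of
-- vertices with |S| ≥ m.
LargestMonoComponentAtLeast : {K : ℕ} → TwoColouredGraph K → ℚ → Set
LargestMonoComponentAtLeast {K} G m =
  Σ Colour λ c → Σ (Fin K) λ v → Σ (Subset K) λ S →
    (∀ w → w ∈ S → TwoColouredGraph.Connected G c v w) × (m ≤ ℕ→ℚ ∣ S ∣)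

-- Fix a vertex v and write N[x] for the closed neighbourhood of x.
--   * If every red neighbour of v is joined to v by a blue path of length two,
--     then all of N[v] lies in the blue component of v, and
--     |N[v]| + K ≥ 2|N[v]| = 2 + 2 deg v.
--   * Otherwise some red neighbour a of v has no blue path v–b–a.  Then every
--     common vertex x of N[v] and N[a] is red-connected to v: if vx is blue,
--     then ax cannot be blue, so v–a–x is red.  By inclusion–exclusion,
--     |N[v] ∩ N[a]| + K ≥ |N[v]| + |N[a]| = 2 + deg v + deg a.
-- In both cases some monochromatic component of v contains a set S with
-- 2 + deg v + deg a ≤ |S| + K, and the minimum-degree bound turns this into
-- |S| ≥ (1-3η)K + ηK + 2η ≥ (1-3η)K.
module Submission where

open import Defs
open import Data.Bool using (true; false)
open import Data.Bool.Properties using () renaming (_≟_ to _≟ᵇ_)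
open import Data.Nat as ℕ using (ℕ; zero; suc)
import Data.Nat.Properties as ℕP
open import Data.Nat.Coprimality using (1-coprimeTo) renaming (sym to coprime-sym)
open import Data.Integer as ℤ using (+_)
import Data.Integer.Properties as ℤP
open import Data.Rational using (ℚ; mkℚ; _/_; _-_; _*_; _+_; -_; _≤_; _<_; 0ℚ; 1ℚ; *≤*; toℚᵘ)
open import Data.Rational.Properties
  using (normalize-coprime; toℚᵘ-injective; toℚᵘ-homo-+; ≤-trans; <⇒≤;
         +-mono-≤; +-monoˡ-≤; +-identityʳ; +-assoc; +-monoʳ-≤; *-zeroʳ; module ≤-Reasoning)
import Data.Rational.Unnormalised as ℚᵘ
import Data.Rational.Unnormalised.Properties as ℚᵘP
open import Data.Rational.Solver using (module +-*-Solver)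
open import Data.Fin using (Fin)
import Data.Fin as Fin
open import Data.Fin.Properties using (any?) renaming (_≟_ to _≟ᶠ_)
open import Data.Fin.Subset using (Subset; _∈_; _∉_; _∪_; _∩_; ⁅_⁆; ∣_∣; inside; outside; Empty)
open import Data.Fin.Subset.Properties
  using (x∈p∩q⁻; x∈p∪q⁻; x∈⁅y⁆⇒x≡y; Empty-unique; ∣⊥∣≡0; ∣⁅x⁆∣≡1; ∣p∣≤n)
open import Data.Vec using (_∷_; [])
open import Data.Vec.Properties using (lookup∘tabulate; []=⇒lookup)
open import Data.Product using (∃; _×_; _,_)
open import Data.Empty using (⊥-elim)
open import Data.Sum using (_⊎_; inj₁; inj₂)
open import Relation.Nullary using (Dec; yes; no; ¬_; ¬?; _×-dec_)
open import Relation.Binary.PropositionalEquality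
  using (_≡_; _≢_; refl; sym; trans; cong; cong₂; subst; subst₂; module ≡-Reasoning)
open import Relation.Binary.Construct.Closure.ReflexiveTransitive using (ε; _◅_)

ℕ→ℚ-normal : ∀ n → ℕ→ℚ n ≡ mkℚ (+ n) 0 (coprime-sym (1-coprimeTo n))
ℕ→ℚ-normal n = normalize-coprime (coprime-sym (1-coprimeTo n))

ℕ→ℚ-mono-≤ : ∀ {m n} → m ℕ.≤ n → ℕ→ℚ m ≤ ℕ→ℚ n
ℕ→ℚ-mono-≤ {m} {n} m≤n rewrite ℕ→ℚ-normal m | ℕ→ℚ-normal n =
  *≤* (subst₂ ℤ._≤_ (sym (ℤP.*-identityʳ (+ m))) (sym (ℤP.*-identityʳ (+ n))) (ℤ.+≤+ m≤n))

ℕ→ℚ-homo-+ : ∀ m n → ℕ→ℚ (m ℕ.+ n) ≡ ℕ→ℚ m + ℕ→ℚ n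
ℕ→ℚ-homo-+ m n =
  toℚᵘ-injective (ℚᵘP.≃-trans sum-of-numerators (ℚᵘP.≃-sym (toℚᵘ-homo-+ (ℕ→ℚ m) (ℕ→ℚ n))))
  where
  -- with denominator 1 on both sides, ℚᵘ addition adds the numerators
  sum-of-numerators : toℚᵘ (ℕ→ℚ (m ℕ.+ n)) ℚᵘ.≃ toℚᵘ (ℕ→ℚ m) ℚᵘ.+ toℚᵘ (ℕ→ℚ n)
  sum-of-numerators rewrite ℕ→ℚ-normal m | ℕ→ℚ-normal n | ℕ→ℚ-normal (m ℕ.+ n) =
    ℚᵘ.*≡* (cong (ℤ._* + 1) (cong₂ ℤ._+_ (sym (ℤP.*-identityʳ (+ m))) (sym (ℤP.*-identityʳ (+ n)))))

0≤1 : 0ℚ ≤ 1ℚ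
0≤1 = *≤* (ℤ.+≤+ ℕ.z≤n)

-- Sums of nonnegative rationals are nonnegative (0 + 0 reduces to 0).
nonneg-+ : ∀ {p q} → 0ℚ ≤ p → 0ℚ ≤ q → 0ℚ ≤ p + q
nonneg-+ = +-mono-≤

+-cancelʳ-≤ : ∀ {p q} r → p + r ≤ q + r → p ≤ q
+-cancelʳ-≤ {p} {q} r p+r≤q+r = subst₂ _≤_ (cancel p) (cancel q) (+-monoˡ-≤ (- r) p+r≤q+r)
  where
  open +-*-Solver
  cancel : ∀ x → x + r - r ≡ x
  cancel x = solve 2 (λ x r → x :+ r :- r := x) refl x r

-- The counting inequality 2 + d₁ + d₂ ≤ s + K, for two degrees d₁, d₂ obeying
-- the (1-η)-completeness bound, forces s ≥ (1-3η)K + ηK + 2η ≥ (1-3η)K.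
size-from-degrees : (η : ℚ) (K d₁ d₂ s : ℕ) → 0ℚ ≤ η → 0ℚ ≤ η * ℕ→ℚ K →
  (1ℚ - η) * (ℕ→ℚ K - 1ℚ) ≤ ℕ→ℚ d₁ → (1ℚ - η) * (ℕ→ℚ K - 1ℚ) ≤ ℕ→ℚ d₂ →
  2 ℕ.+ d₁ ℕ.+ d₂ ℕ.≤ s ℕ.+ K → (1ℚ - (+ 3) / 1 * η) * ℕ→ℚ K ≤ ℕ→ℚ s
size-from-degrees η K d₁ d₂ s 0≤η 0≤ηK d₁-bound d₂-bound count =
  +-cancelʳ-≤ (k + slack) (begin
    x + (k + slack)           ≡⟨ identity η k ⟩
    ℕ→ℚ 2 + a + a             ≤⟨ +-mono-≤ (+-monoʳ-≤ (ℕ→ℚ 2) d₁-bound) d₂-bound ⟩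
    ℕ→ℚ 2 + ℕ→ℚ d₁ + ℕ→ℚ d₂   ≡⟨ sym casts-of-sum ⟩
    ℕ→ℚ (2 ℕ.+ d₁ ℕ.+ d₂)     ≤⟨ ℕ→ℚ-mono-≤ count ⟩
    ℕ→ℚ (s ℕ.+ K)             ≡⟨ ℕ→ℚ-homo-+ s K ⟩
    ℕ→ℚ s + k                 ≡⟨ sym (+-identityʳ (ℕ→ℚ s + k)) ⟩
    ℕ→ℚ s + k + 0ℚ            ≤⟨ +-monoʳ-≤ (ℕ→ℚ s + k) (nonneg-+ 0≤ηK (nonneg-+ 0≤η 0≤η)) ⟩
    ℕ→ℚ s + k + slack         ≡⟨ +-assoc (ℕ→ℚ s) k slack ⟩
    ℕ→ℚ s + (k + slack)       ∎)
  where
  open ≤-Reasoning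
  open +-*-Solver
  k x a slack : ℚ
  k = ℕ→ℚ K
  x = (1ℚ - (+ 3) / 1 * η) * k
  a = (1ℚ - η) * (k - 1ℚ)
  slack = η * k + (η + η)
  identity : ∀ η k → (1ℚ - (+ 3) / 1 * η) * k + (k + (η * k + (η + η)))
                   ≡ ℕ→ℚ 2 + (1ℚ - η) * (k - 1ℚ) + (1ℚ - η) * (k - 1ℚ)
  identity = solve 2 (λ η k →
      (con 1ℚ :- con ((+ 3) / 1) :* η) :* k :+ (k :+ (η :* k :+ (η :+ η)))
    := con (ℕ→ℚ 2) :+ (con 1ℚ :- η) :* (k :- con 1ℚ) :+ (con 1ℚ :- η) :* (k :- con 1ℚ)) refl
  casts-of-sum : ℕ→ℚ (2 ℕ.+ d₁ ℕ.+ d₂) ≡ ℕ→ℚ 2 + ℕ→ℚ d₁ + ℕ→ℚ d₂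
  casts-of-sum = trans (ℕ→ℚ-homo-+ (2 ℕ.+ d₁) d₂) (cong (_+ ℕ→ℚ d₂) (ℕ→ℚ-homo-+ 2 d₁))

∣p∪q∣+∣p∩q∣≡∣p∣+∣q∣ : ∀ {n} (p q : Subset n) → ∣ p ∪ q ∣ ℕ.+ ∣ p ∩ q ∣ ≡ ∣ p ∣ ℕ.+ ∣ q ∣
∣p∪q∣+∣p∩q∣≡∣p∣+∣q∣ []            []            = refl
∣p∪q∣+∣p∩q∣≡∣p∣+∣q∣ (inside ∷ p)  (inside ∷ q)  = cong suc (begin
  ∣ p ∪ q ∣ ℕ.+ suc ∣ p ∩ q ∣  ≡⟨ ℕP.+-suc ∣ p ∪ q ∣ ∣ p ∩ q ∣ ⟩
  suc (∣ p ∪ q ∣ ℕ.+ ∣ p ∩ q ∣) ≡⟨ cong suc (∣p∪q∣+∣p∩q∣≡∣p∣+∣q∣ p q) ⟩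
  suc (∣ p ∣ ℕ.+ ∣ q ∣)         ≡⟨ sym (ℕP.+-suc ∣ p ∣ ∣ q ∣) ⟩
  ∣ p ∣ ℕ.+ suc ∣ q ∣           ∎)
  where open ≡-Reasoning
∣p∪q∣+∣p∩q∣≡∣p∣+∣q∣ (inside ∷ p)  (outside ∷ q) = cong suc (∣p∪q∣+∣p∩q∣≡∣p∣+∣q∣ p q)
∣p∪q∣+∣p∩q∣≡∣p∣+∣q∣ (outside ∷ p) (inside ∷ q)  =
  trans (cong suc (∣p∪q∣+∣p∩q∣≡∣p∣+∣q∣ p q)) (sym (ℕP.+-suc ∣ p ∣ ∣ q ∣))
∣p∪q∣+∣p∩q∣≡∣p∣+∣q∣ (outside ∷ p) (outside ∷ q) = ∣p∪q∣+∣p∩q∣≡∣p∣+∣q∣ p q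

∣⁅x⁆∪p∣≡1+∣p∣ : ∀ {n} {x : Fin n} {p : Subset n} → x ∉ p → ∣ ⁅ x ⁆ ∪ p ∣ ≡ suc ∣ p ∣
∣⁅x⁆∪p∣≡1+∣p∣ {n} {x} {p} x∉p = begin
  ∣ ⁅ x ⁆ ∪ p ∣                          ≡⟨ sym (ℕP.+-identityʳ _) ⟩
  ∣ ⁅ x ⁆ ∪ p ∣ ℕ.+ 0                    ≡⟨ cong (∣ ⁅ x ⁆ ∪ p ∣ ℕ.+_) (sym size-of-overlap) ⟩
  ∣ ⁅ x ⁆ ∪ p ∣ ℕ.+ ∣ ⁅ x ⁆ ∩ p ∣        ≡⟨ ∣p∪q∣+∣p∩q∣≡∣p∣+∣q∣ ⁅ x ⁆ p ⟩
  ∣ ⁅ x ⁆ ∣ ℕ.+ ∣ p ∣                    ≡⟨ cong (ℕ._+ ∣ p ∣) (∣⁅x⁆∣≡1 x) ⟩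
  suc ∣ p ∣                              ∎
  where
  open ≡-Reasoning
  no-overlap : Empty (⁅ x ⁆ ∩ p)
  no-overlap (y , y∈⁅x⁆∩p) with x∈p∩q⁻ ⁅ x ⁆ p y∈⁅x⁆∩p
  ... | y∈⁅x⁆ , y∈p = x∉p (subst (_∈ p) (x∈⁅y⁆⇒x≡y x y∈⁅x⁆) y∈p)
  size-of-overlap : ∣ ⁅ x ⁆ ∩ p ∣ ≡ 0
  size-of-overlap = trans (cong ∣_∣ (Empty-unique no-overlap)) (∣⊥∣≡0 n)

_≟ᶜ_ : (c d : Colour) → Dec (c ≡ d)
red  ≟ᶜ red  = yes refl
blue ≟ᶜ blue = yes refl
red  ≟ᶜ blue = no λ ()
blue ≟ᶜ red  = no λ ()

module _ {K : ℕ} (G : TwoColouredGraph K) where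
  open TwoColouredGraph G

  edge? : ∀ c u w → Dec (Edge c u w)
  edge? c u w = (adj u w ≟ᵇ true) ×-dec (col u w ≟ᶜ c)

  edge-sym : ∀ {c u w} → Edge c u w → Edge c w u
  edge-sym {c} {u} {w} (uw , colour) = trans (adj-sym w u) uw , trans (col-sym w u) colour

  edge-colour : ∀ {u w} → adj u w ≡ true → Edge red u w ⊎ Edge blue u w
  edge-colour {u} {w} uw with col u w
  ... | red  = inj₁ (uw , refl)
  ... | blue = inj₂ (uw , refl)

  TwoStep : Colour → Fin K → Fin K → Set
  TwoStep c u w = ∃ λ b → Edge c u b × Edge c b w

  twoStep? : ∀ c u w → Dec (TwoStep c u w)
  twoStep? c u w = any? (λ b → edge? c u b ×-dec edge? c b w)

  twoStep-connected : ∀ {c u w} → TwoStep c u w → Connected c u w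
  twoStep-connected (b , ub , bw) = ub ◅ bw ◅ ε

  N[_] : Fin K → Subset K
  N[ v ] = ⁅ v ⁆ ∪ nbhd v

  ∈nbhd⁻ : ∀ {v w} → w ∈ nbhd v → adj v w ≡ true
  ∈nbhd⁻ {v} {w} w∈ = trans (sym (lookup∘tabulate (adj v) w)) ([]=⇒lookup w∈)

  ∈N[_]⁻ : ∀ v {w} → w ∈ N[ v ] → w ≡ v ⊎ adj v w ≡ true
  ∈N[ v ]⁻ w∈ with x∈p∪q⁻ ⁅ v ⁆ (nbhd v) w∈
  ... | inj₁ w∈⁅v⁆   = inj₁ (x∈⁅y⁆⇒x≡y v w∈⁅v⁆)
  ... | inj₂ w∈nbhd = inj₂ (∈nbhd⁻ w∈nbhd)

  ∣N[_]∣ : ∀ v → ∣ N[ v ] ∣ ≡ suc (degree v)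
  ∣N[ v ]∣ = ∣⁅x⁆∪p∣≡1+∣p∣ λ v∈nbhd → false≢true (trans (sym (adj-irr v)) (∈nbhd⁻ v∈nbhd))
    where
    false≢true : false ≢ true
    false≢true ()

  record LargeComponentAt (v : Fin K) : Set where
    field
      colour    : Colour
      partner   : Fin K
      members   : Subset K
      connected : ∀ w → w ∈ members → Connected colour v w
      large     : 2 ℕ.+ degree v ℕ.+ degree partner ℕ.≤ ∣ members ∣ ℕ.+ K

  blue-case : ∀ v → (∀ a → Edge red v a → TwoStep blue v a) → LargeComponentAt v
  blue-case v red⇒twoStep = record
    { colour = blue ; partner = v ; members = N[ v ] ; connected = connected ; large = large }
    where
    connected : ∀ w → w ∈ N[ v ] → Connected blue v w
    connected w w∈ with ∈N[ v ]⁻ w∈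
    ... | inj₁ refl = ε
    ... | inj₂ vw with edge-colour vw
    ...   | inj₁ red-vw  = twoStep-connected (red⇒twoStep w red-vw)
    ...   | inj₂ blue-vw = blue-vw ◅ ε
    large : 2 ℕ.+ degree v ℕ.+ degree v ℕ.≤ ∣ N[ v ] ∣ ℕ.+ K
    large = subst (ℕ._≤ ∣ N[ v ] ∣ ℕ.+ K)
                  (trans (cong₂ ℕ._+_ ∣N[ v ]∣ ∣N[ v ]∣) (cong suc (ℕP.+-suc (degree v) (degree v))))
                  (ℕP.+-monoʳ-≤ ∣ N[ v ] ∣ (∣p∣≤n N[ v ]))

  red-case : ∀ v a → Edge red v a → ¬ TwoStep blue v a → LargeComponentAt v
  red-case v a red-va no-blue-path = record
    { colour = red ; partner = a ; members = N[ v ] ∩ N[ a ] ; connected = connected ; large = large }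
    where
    connected : ∀ w → w ∈ N[ v ] ∩ N[ a ] → Connected red v w
    connected w w∈ with x∈p∩q⁻ N[ v ] N[ a ] w∈
    ... | w∈N[v] , w∈N[a] with ∈N[ v ]⁻ w∈N[v]
    ...   | inj₁ refl = ε
    ...   | inj₂ vw with edge-colour vw
    ...     | inj₁ red-vw = red-vw ◅ ε
    ...     | inj₂ blue-vw with ∈N[ a ]⁻ w∈N[a]
    ...       | inj₁ refl = red-va ◅ ε
    ...       | inj₂ aw with edge-colour aw
    ...         | inj₁ red-aw  = red-va ◅ red-aw ◅ ε
    ...         | inj₂ blue-aw = ⊥-elim (no-blue-path (w , blue-vw , edge-sym blue-aw))
    large : 2 ℕ.+ degree v ℕ.+ degree a ℕ.≤ ∣ N[ v ] ∩ N[ a ] ∣ ℕ.+ K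
    large = begin
      2 ℕ.+ degree v ℕ.+ degree a                  ≡⟨ cong suc (sym (ℕP.+-suc (degree v) (degree a))) ⟩
      suc (degree v) ℕ.+ suc (degree a)            ≡⟨ sym (cong₂ ℕ._+_ ∣N[ v ]∣ ∣N[ a ]∣) ⟩
      ∣ N[ v ] ∣ ℕ.+ ∣ N[ a ] ∣                    ≡⟨ sym (∣p∪q∣+∣p∩q∣≡∣p∣+∣q∣ N[ v ] N[ a ]) ⟩
      ∣ N[ v ] ∪ N[ a ] ∣ ℕ.+ ∣ N[ v ] ∩ N[ a ] ∣  ≡⟨ ℕP.+-comm ∣ N[ v ] ∪ N[ a ] ∣ _ ⟩
      ∣ N[ v ] ∩ N[ a ] ∣ ℕ.+ ∣ N[ v ] ∪ N[ a ] ∣  ≤⟨ ℕP.+-monoʳ-≤ ∣ N[ v ] ∩ N[ a ] ∣ (∣p∣≤n (N[ v ] ∪ N[ a ])) ⟩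
      ∣ N[ v ] ∩ N[ a ] ∣ ℕ.+ K                    ∎
      where open ℕP.≤-Reasoning

  largeComponentAt : ∀ v → LargeComponentAt v
  largeComponentAt v with any? (λ a → edge? red v a ×-dec ¬? (twoStep? blue v a))
  ... | yes (a , red-va , no-blue-path) = red-case v a red-va no-blue-path
  ... | no no-lonely-neighbour = blue-case v red⇒twoStep
    where
    red⇒twoStep : ∀ a → Edge red v a → TwoStep blue v a
    red⇒twoStep a red-va with twoStep? blue v a
    ... | yes path = path
    ... | no no-path with no-lonely-neighbour (a , red-va , no-path)
    ...   | ()

aVertex : ∀ η K → 1ℚ ≤ η * ℕ→ℚ K → Fin K
aVertex η zero    1≤η*0 with subst (1ℚ ≤_) (*-zeroʳ η) 1≤η*0
... | *≤* (ℤ.+≤+ ())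
aVertex η (suc K) _ = Fin.zero

lemma6p17 : (η : ℚ) → 0ℚ < η → η < (+ 1) / 3 → (K : ℕ) → 1ℚ ≤ η * ℕ→ℚ K →
    (G : TwoColouredGraph K) → AlmostComplete η G →
    LargestMonoComponentAtLeast G ((1ℚ - (+ 3) / 1 * η) * ℕ→ℚ K)
lemma6p17 η 0<η _ K 1≤ηK G almostComplete = colour , v , members , connected , size-bound
  where
  open TwoColouredGraph G using (degree)
  v = aVertex η K 1≤ηK
  open LargeComponentAt (largeComponentAt G v)
  size-bound : (1ℚ - (+ 3) / 1 * η) * ℕ→ℚ K ≤ ℕ→ℚ ∣ members ∣
  size-bound = size-from-degrees η K (degree v) (degree partner) ∣ members ∣
    (<⇒≤ 0<η) (≤-trans 0≤1 1≤ηK) (almostComplete v) (almostComplete partner) large
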